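{- Let $k$ and $n$ be positive integers. If $k$ divides $n$, then the hypercube $Q_k$ divides the hypercube $Q_n$.
   Context: $Q_n$ is the $n$-dimensional hypercube: vertex set the subsets of $\{1,\ldots,n\}$, with $x,y$ adjacent iff $|x\,\Delta\, y|=1$. If $H$ is isomorphic to a subgraph of $G$, $H$ divides $G$ if there exist embeddings $\theta_1,\ldots,\theta_r$ of $H$ into $G$ such that $\{E(\theta_1(H)),\ldots,E(\theta_r(H))\}$ is a partition of $E(G)$. -}

module Defs where

open import Data.Nat using (ℕ; zero; suc; _+_)
open import Data.Bool using (Bool; true; false; _≟_)
open import Data.Vec using (Vec; []; _∷_)
open import Data.Fin using (Fin)
open import Data.Product using (Σ; ∃; _×_; _,_)
open import Relation.Nullary using (yes; no)
open import Relation.Binary.PropositionalEquality using (_≡_)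
open import Function.Definitions using (Injective)

-- Vertices of Q_n: subsets of {1,…,n}, encoded as characteristic vectors.
Vertex : ℕ → Set
Vertex n = Vec Bool n

symDiffSize : ∀ {n} → Vertex n → Vertex n → ℕ
symDiffSize [] [] = 0
symDiffSize (a ∷ x) (b ∷ y) with a ≟ b
... | yes _ = symDiffSize x y
... | no  _ = suc (symDiffSize x y)

Adj : ∀ {n} → Vertex n → Vertex n → Set
Adj x y = symDiffSize x y ≡ 1

record Embedding (k n : ℕ) : Set where
  field
    map       : Vertex k → Vertex n
    injective : Injective _≡_ _≡_ map
    preserves : ∀ {x y} → Adj x y → Adj (map x) (map y)

open Embedding public

InImage : ∀ {k n} → Embedding k n → Vertex n → Vertex n → Set
InImage {k} θ u v =
  Σ (Vertex k) λ x → Σ (Vertex k) λ y →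
    Adj x y × map θ x ≡ u × map θ y ≡ v

Divides : ℕ → ℕ → Set
Divides k n =
  Σ ℕ λ r → Σ (Fin r → Embedding k n) λ θ →
    ∀ (u v : Vertex n) → Adj u v →
      Σ (Fin r) λ i → InImage (θ i) u v × (∀ j → InImage (θ j) u v → j ≡ i)

module Submission where

-- Split the coordinates of Q (k + a) into a first block of k and
-- a second block of a coordinates, so that every vertex is x ++ y with
-- x ∈ Q k, y ∈ Q a.  An edge of Q (k + a) changes exactly one coordinate, so
-- it either changes the first block (y fixed) or the second block (x fixed).
-- Hence, given a family θ_i dividing Q a, the embeddings
--   x ↦ x ++ y        (one for each y ∈ Q a)   and
--   z ↦ x ++ θ_i z    (one for each x ∈ Q k and each i)
-- divide Q (k + a).  Iterating from Q 0 (which has no edges) shows that Q k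
-- divides Q (m * k) for every m.

open import Defs
open import Data.Nat using (ℕ; zero; suc; _+_; _*_; _^_; _≤_)
open import Data.Nat.Properties using (+-identityʳ)
open import Data.Nat.Divisibility using (_∣_; divides)
open import Data.Bool using (Bool; _≟_)
open import Data.Vec using ([]; _∷_; _++_; splitAt)
open import Data.Vec.Properties using (++-injectiveˡ; ++-injectiveʳ)
open import Data.Fin using (Fin)
open import Data.Fin.Properties using (0↔⊥; 1↔⊤; 2↔Bool; +↔⊎; *↔×)
open import Data.Product using (Σ; _×_; _,_; proj₁)
open import Data.Product.Function.NonDependent.Propositional using (_×-↔_)
open import Data.Sum using (_⊎_; inj₁; inj₂)
open import Data.Sum.Function.Propositional using (_⊎-↔_)
open import Data.Unit using (tt)
open import Data.Empty using (⊥; ⊥-elim)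
open import Function.Bundles using (_↔_; mk↔ₛ′; Inverse)
open import Function.Properties.Inverse using (↔-refl; ↔-trans)
open import Relation.Nullary using (¬_; yes; no)
open import Relation.Binary.PropositionalEquality
  using (_≡_; refl; sym; trans; cong; subst)

symDiff-self : ∀ {n} (x : Vertex n) → symDiffSize x x ≡ 0
symDiff-self []      = refl
symDiff-self (a ∷ x) with a ≟ a
... | yes _  = symDiff-self x
... | no a≢a = ⊥-elim (a≢a refl)

symDiff-zero : ∀ {n} (x y : Vertex n) → symDiffSize x y ≡ 0 → x ≡ y
symDiff-zero []      []      _ = refl
symDiff-zero (a ∷ x) (b ∷ y) p with a ≟ b | p
... | yes refl | p′ = cong (a ∷_) (symDiff-zero x y p′)
... | no _     | ()

symDiff-++ : ∀ {m n} (x x′ : Vertex m) (y y′ : Vertex n) →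
  symDiffSize (x ++ y) (x′ ++ y′) ≡ symDiffSize x x′ + symDiffSize y y′
symDiff-++ []      []       y y′ = refl
symDiff-++ (a ∷ x) (b ∷ x′) y y′ with a ≟ b
... | yes _ = symDiff-++ x x′ y y′
... | no  _ = cong suc (symDiff-++ x x′ y y′)

adj⇒≢ : ∀ {n} {x y : Vertex n} → Adj x y → ¬ x ≡ y
adj⇒≢ {x = x} adj refl with trans (sym (symDiff-self x)) adj
... | ()

adj-++ˡ : ∀ {k a} {x x′ : Vertex k} (y : Vertex a) → Adj x x′ → Adj (x ++ y) (x′ ++ y)
adj-++ˡ {x = x} {x′} y adj = trans (symDiff-++ x x′ y y)
  (trans (cong (symDiffSize x x′ +_) (symDiff-self y)) (trans (+-identityʳ _) adj))

adj-++ʳ : ∀ {k a} (x : Vertex k) {y y′ : Vertex a} → Adj y y′ → Adj (x ++ y) (x ++ y′)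
adj-++ʳ x {y} {y′} adj = trans (symDiff-++ x x y y′)
  (trans (cong (_+ symDiffSize y y′) (symDiff-self x)) adj)

sum≡1 : ∀ m n → m + n ≡ 1 → (m ≡ 1 × n ≡ 0) ⊎ (m ≡ 0 × n ≡ 1)
sum≡1 zero          n    p  = inj₂ (refl , p)
sum≡1 (suc zero)    zero _  = inj₁ (refl , refl)
sum≡1 (suc zero)    (suc _) ()
sum≡1 (suc (suc _)) _    ()

adj-++-cases : ∀ {k a} (x x′ : Vertex k) (y y′ : Vertex a) →
  Adj (x ++ y) (x′ ++ y′) → (Adj x x′ × y ≡ y′) ⊎ (x ≡ x′ × Adj y y′)
adj-++-cases x x′ y y′ adj with sum≡1 _ _ (trans (sym (symDiff-++ x x′ y y′)) adj)
... | inj₁ (adjˡ , sameʳ) = inj₁ (adjˡ , symDiff-zero y y′ sameʳ)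
... | inj₂ (sameˡ , adjʳ) = inj₂ (symDiff-zero x x′ sameˡ , adjʳ)

layer : ∀ {k a} → Vertex a → Embedding k (k + a)
layer y = record
  { map       = _++ y
  ; injective = λ {x} {x′} → ++-injectiveˡ x x′
  ; preserves = λ {x} {x′} → adj-++ˡ {x = x} {x′} y
  }

shift : ∀ {k a} → Vertex k → Embedding k a → Embedding k (k + a)
shift x θ = record
  { map       = λ z → x ++ map θ z
  ; injective = λ eq → injective θ (++-injectiveʳ x x eq)
  ; preserves = λ adj → adj-++ʳ x (preserves θ adj)
  }

layer-image : ∀ {k a} (y : Vertex a) (ux vx : Vertex k) (uy vy : Vertex a) →
  InImage (layer {k} y) (ux ++ uy) (vx ++ vy) → y ≡ uy × y ≡ vy
layer-image y ux vx uy vy (x , x′ , _ , eu , ev) =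
  ++-injectiveʳ x ux eu , ++-injectiveʳ x′ vx ev

shift-image : ∀ {k a} (x : Vertex k) (θ : Embedding k a) (ux vx : Vertex k) (uy vy : Vertex a) →
  InImage (shift x θ) (ux ++ uy) (vx ++ vy) → x ≡ ux × x ≡ vx × InImage θ uy vy
shift-image x θ ux vx uy vy (z , z′ , adj , eu , ev) =
  ++-injectiveˡ x ux eu , ++-injectiveˡ x vx ev ,
  (z , z′ , adj , ++-injectiveʳ x ux eu , ++-injectiveʳ x vx ev)

-- A family of embeddings of Q k into Q n, indexed by I, whose edge images
-- partition E(Q n).  Divides k n is exactly Σ r (Partition k n (Fin r)).
Partition : ℕ → ℕ → Set → Set
Partition k n I = Σ (I → Embedding k n) λ θ →
  ∀ (u v : Vertex n) → Adj u v →
    Σ I λ i → InImage (θ i) u v × (∀ j → InImage (θ j) u v → j ≡ i)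

reindex : ∀ {k n} {I J : Set} → J ↔ I → Partition k n I → Partition k n J
reindex {J = J} e (θ , cover) = (λ j → θ (to j)) , cover′
  where
  open Inverse e
  cover′ : ∀ u v → Adj u v →
    Σ J λ j → InImage (θ (to j)) u v × (∀ j′ → InImage (θ (to j′)) u v → j′ ≡ j)
  cover′ u v adj with cover u v adj
  ... | i , covered , unique =
    from i ,
    subst (λ i′ → InImage (θ i′) u v) (sym (strictlyInverseˡ i)) covered ,
    λ j′ covered′ → trans (sym (strictlyInverseʳ j′)) (cong from (unique (to j′) covered′))

partition-zero : ∀ k → Partition k 0 ⊥
partition-zero k = (λ ()) , λ { [] [] () }

partition-step : ∀ {k a} {I : Set} → Partition k a I →
  Partition k (k + a) (Vertex a ⊎ (Vertex k × I))
partition-step {k} {a} {I} (θ , cover) = Θ , cover′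
  where
  Θ : Vertex a ⊎ (Vertex k × I) → Embedding k (k + a)
  Θ (inj₁ y)       = layer y
  Θ (inj₂ (x , i)) = shift x (θ i)

  first-block : ∀ (ux vx : Vertex k) (y : Vertex a) → Adj ux vx →
    ∀ j → InImage (Θ j) (ux ++ y) (vx ++ y) → j ≡ inj₁ y
  first-block ux vx y _   (inj₁ y′) covered = cong inj₁ (proj₁ (layer-image y′ ux vx y y covered))
  first-block ux vx y adj (inj₂ (x , i)) covered with shift-image x (θ i) ux vx y y covered
  ... | refl , refl , _ = ⊥-elim (adj⇒≢ {x = x} {x} adj refl)

  second-block : ∀ (x : Vertex k) (uy vy : Vertex a) (i : I) →
    (∀ i′ → InImage (θ i′) uy vy → i′ ≡ i) → Adj uy vy →
    ∀ j → InImage (Θ j) (x ++ uy) (x ++ vy) → j ≡ inj₂ (x , i)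
  second-block x uy vy i unique adj (inj₁ y) covered with layer-image y x x uy vy covered
  ... | refl , refl = ⊥-elim (adj⇒≢ {x = y} {y} adj refl)
  second-block x uy vy i unique adj (inj₂ (x′ , i′)) covered with shift-image x′ (θ i′) x x uy vy covered
  ... | refl , _ , coveredθ with unique i′ coveredθ
  ... | refl = refl

  cover′ : ∀ u v → Adj u v →
    Σ _ λ j → InImage (Θ j) u v × (∀ j′ → InImage (Θ j′) u v → j′ ≡ j)
  cover′ u v adj with splitAt k u | splitAt k v
  ... | ux , uy , refl | vx , vy , refl with adj-++-cases ux vx uy vy adj
  ... | inj₁ (adjˣ , refl) =
    inj₁ uy , (ux , vx , adjˣ , refl , refl) , first-block ux vx uy adjˣ
  ... | inj₂ (refl , adjʸ) with cover uy vy adjʸ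
  ... | i , (z , z′ , adjᶻ , eu , ev) , unique =
    inj₂ (ux , i) ,
    (z , z′ , adjᶻ , cong (ux ++_) eu , cong (ux ++_) ev) ,
    second-block ux uy vy i unique adjʸ

vertices↔ : ∀ n → Fin (2 ^ n) ↔ Vertex n
vertices↔ zero    = ↔-trans 1↔⊤ (mk↔ₛ′ (λ _ → []) (λ _ → tt) (λ { [] → refl }) (λ _ → refl))
vertices↔ (suc n) = ↔-trans *↔× (↔-trans (2↔Bool ×-↔ vertices↔ n) cons↔)
  where
  cons↔ : (Bool × Vertex n) ↔ Vertex (suc n)
  cons↔ = mk↔ₛ′ (λ { (b , x) → b ∷ x }) (λ { (b ∷ x) → b , x })
                (λ { (_ ∷ _) → refl }) (λ { (_ , _) → refl })

divides-step : ∀ {k a} → Divides k a → Divides k (k + a)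
divides-step {k} {a} (r , partition) =
  2 ^ a + 2 ^ k * r ,
  reindex (↔-trans +↔⊎ (vertices↔ a ⊎-↔ ↔-trans *↔× (vertices↔ k ×-↔ ↔-refl)))
          (partition-step partition)

divides-multiple : ∀ k m → Divides k (m * k)
divides-multiple k zero    = 0 , reindex 0↔⊥ (partition-zero k)
divides-multiple k (suc m) = divides-step (divides-multiple k m)

proposition4 : (k n : ℕ) → 1 ≤ k → 1 ≤ n → k ∣ n → Divides k n
proposition4 k n _ _ (divides m refl) = divides-multiple k m
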